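{- In QHC, each of the following principles is equivalent to the H-principle $\cdot\,?(\gamma\lor\neg\gamma)$, meaning that each is derivable in QHC from the H-principle and the H-principle is derivable in QHC from it: 1. $\cdot\,?(\neg\neg\alpha\to\alpha)$; 2. $\cdot\,?\neg\alpha\leftrightarrow\neg ?\alpha$; 3. $\cdot\,\nabla\alpha\leftrightarrow\neg\neg\alpha$; 4. $\cdot\,?(\nabla\alpha\lor\neg\nabla\alpha)$; 5. $\cdot\,\neg\neg\nabla\alpha\to\nabla\alpha$; 6. $\cdot\,?(\neg\neg\nabla\alpha\to\nabla\alpha)$; 7. $\cdot\,?(\alpha\to\beta)\leftrightarrow(?\alpha\to ?\beta)$; 8. $\cdot\,(\Box p\to\Box q)\leftrightarrow\Box(\Box p\to\Box q)$; 9. $\cdot\,\Box p\leftrightarrow\Diamond\Box p$; 10. $\cdot\,\Diamond p\leftrightarrow\Box\Diamond p$. Here $\Box F:=\,?!F$, $\Diamond F:=\neg\Box\neg F$ (classical $\neg$) and $\nabla\Phi:=\,!?\Phi$.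
   Context: Meta-logical framework. Formulas of a first-order language may contain individual variables and predicate variables. Meta-formulas are built from formulas using meta-conjunction $\&$, meta-implication $\Rightarrow$, and universal meta-quantifiers over individual and predicate variables. A principle $\cdot G$, for a formula $G$, is the meta-formula obtained by universally meta-quantifying all free individual variables of $G$ and then all predicate variables of $G$. A rule $F_1,\dots,F_m/G$ is the meta-formula $\forall^2(\forall^1F_1\,\&\cdots\&\,\forall^1F_m\Rightarrow\forall^1G)$, where $\forall^1$ meta-quantifies the free individual variables of the formula it precedes and $\forall^2$ meta-quantifies all predicate variables occurring. A logic $L$ is given by a derivation system $\mathcal D$, a meta-conjunction of finitely many principles and rules. For a meta-formula $\mathcal F$, $\vdash_L\mathcal F$ means that $\mathcal D\Rightarrow\mathcal F$ is derivable by the natural-deduction meta-rules: introduction and elimination of $\&$, $\Rightarrow$ and the universal meta-quantifiers (elimination allows substituting terms for individual variables and formulas for predicate variables), plus $\alpha$-conversion. The notation $\mathcal F\vdash_L\mathcal G$ means $\vdash_L\mathcal F\Rightarrow\mathcal G$. Language of QHC. It has individual variables and, for each $n\ge0$, countably many $n$-ary problem variables $\alpha,\beta,\gamma,\delta,\theta,\dots$ and countably many $n$-ary proper predicate variables $p,q,\dots$. - A c-formula is $\top$, $\bot$, an atom $p(x_1,\dots,x_n)$, or $?\Phi$ for an i-formula $\Phi$, closed under the classical connectives $\land,\lor,\to,\leftrightarrow,\neg$ and quantifiers $\exists,\forall$. - An i-formula is $\checkmark$ (triviality), $\curlywedge$ (absurdity), an atom $\alpha(x_1,\dots,x_n)$,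 or $!F$ for a c-formula $F$, closed under the intuitionistic connectives $\land,\lor,\to,\leftrightarrow,\neg$ (with $\neg\Phi:=\Phi\to\curlywedge$) and quantifiers $\exists,\forall$. Connectives applied to c-formulas are classical; those applied to i-formulas are intuitionistic. QHC is the logic whose derivation system consists of: - (0a) all laws and rules of classical predicate logic QC, for c-formulas; - (0b) all laws and rules of intuitionistic predicate logic QH, for i-formulas; - the principles $\cdot\,?(\gamma\land\delta)\leftrightarrow ?\gamma\land ?\delta$, $\cdot\,?(\gamma\lor\delta)\leftrightarrow ?\gamma\lor ?\delta$, $\cdot\,?(\gamma\to\delta)\to(?\gamma\to ?\delta)$, $\cdot\,\neg ?\curlywedge$, $\cdot\,?\exists x\,\theta(x)\leftrightarrow\exists x\,?\theta(x)$, $\cdot\,?\forall x\,\theta(x)\to\forall x\,?\theta(x)$, $\cdot\,\gamma\to\,!?\gamma$, $\cdot\,\neg !\bot$, $\cdot\,?!p\to p$, $\cdot\,!p\to\,!?!p$ and $\cdot\,!(p\to q)\to(!p\to !q)$; - the rules $!p/p$ and $p/!p$. -}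

module Defs where

open import Data.Nat using (ℕ; zero; suc)
open import Data.Vec using (Vec; map)
open import Data.Product using (_×_)

-- Individual variables are de Bruijn indices (ℕ); there are no function
-- symbols, so terms are variables.  ∀' φ and ∃' φ bind index 0 in φ.
-- Sort cl = c-formulas (classical), int = i-formulas (intuitionistic).
-- atom {cl} n k xs is the k-th n-ary proper predicate variable p applied
-- to xs; atom {int} n k xs is the k-th n-ary problem variable α.
-- tru {cl} = ⊤, fal {cl} = ⊥, tru {int} = ✓ (triviality),
-- fal {int} = ⋏ (absurdity).  ⁇ is the operator "?", ! is "!".

data Sort : Set where
  cl int : Sort

infixr 9 ⁇_ !_
infixr 6 _∧_
infixr 5 _∨_
infixr 4 _⇒_
infix 3 _↔_

data Fm : Sort → Set where
  tru fal : ∀ {s} → Fm s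
  atom    : ∀ {s} (n k : ℕ) → Vec ℕ n → Fm s
  ⁇_      : Fm int → Fm cl
  !_      : Fm cl → Fm int
  _∧_ _∨_ _⇒_ : ∀ {s} → Fm s → Fm s → Fm s
  ∀' ∃'   : ∀ {s} → Fm s → Fm s

infixr 9 ¬_
¬_ : ∀ {s} → Fm s → Fm s
¬ φ = φ ⇒ fal

_↔_ : ∀ {s} → Fm s → Fm s → Fm s
φ ↔ ψ = (φ ⇒ ψ) ∧ (ψ ⇒ φ)

□_ : Fm cl → Fm cl
□ F = ⁇ ! F

◇_ : Fm cl → Fm cl
◇ F = ¬ □ ¬ F

∇_ : Fm int → Fm int
∇ Φ = ! ⁇ Φ

infixr 9 □_ ◇_ ∇_

pv : ℕ → Fm cl
pv k = atom 0 k Data.Vec.[]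

lift : (ℕ → ℕ) → ℕ → ℕ
lift ρ zero    = zero
lift ρ (suc k) = suc (ρ k)

ren : ∀ {s} → (ℕ → ℕ) → Fm s → Fm s
ren ρ tru          = tru
ren ρ fal          = fal
ren ρ (atom n k xs) = atom n k (map ρ xs)
ren ρ (⁇ φ)        = ⁇ ren ρ φ
ren ρ (! φ)        = ! ren ρ φ
ren ρ (φ ∧ ψ)      = ren ρ φ ∧ ren ρ ψ
ren ρ (φ ∨ ψ)      = ren ρ φ ∨ ren ρ ψ
ren ρ (φ ⇒ ψ)      = ren ρ φ ⇒ ren ρ ψ
ren ρ (∀' φ)       = ∀' (ren (lift ρ) φ)
ren ρ (∃' φ)       = ∃' (ren (lift ρ) φ)

wk : ∀ {s} → Fm s → Fm s
wk = ren suc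

sub0 : ℕ → ℕ → ℕ
sub0 t zero    = t
sub0 t (suc k) = k

inst : ∀ {s} → ℕ → Fm s → Fm s
inst t = ren (sub0 t)

-- A "provability interpretation" P assigns to every formula
-- the meta-proposition "∀¹ φ" (φ universally closed over its free
-- individual variables).  A principle is a scheme: it asserts P of all
-- substitution instances.  D ⇒ F is derivable iff it holds for every
-- interpretation P of the atoms.

Pred : Set₁
Pred = ∀ {s} → Fm s → Set

Principle : Set₁
Principle = Pred → Set

record IsQHC (P : Pred) : Set where
  field
    ax-K   : ∀ {s} (φ ψ : Fm s) → P (φ ⇒ (ψ ⇒ φ))
    ax-S   : ∀ {s} (φ ψ χ : Fm s) → P ((φ ⇒ (ψ ⇒ χ)) ⇒ ((φ ⇒ ψ) ⇒ (φ ⇒ χ)))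
    ax-∧I  : ∀ {s} (φ ψ : Fm s) → P (φ ⇒ (ψ ⇒ φ ∧ ψ))
    ax-∧E₁ : ∀ {s} (φ ψ : Fm s) → P (φ ∧ ψ ⇒ φ)
    ax-∧E₂ : ∀ {s} (φ ψ : Fm s) → P (φ ∧ ψ ⇒ ψ)
    ax-∨I₁ : ∀ {s} (φ ψ : Fm s) → P (φ ⇒ φ ∨ ψ)
    ax-∨I₂ : ∀ {s} (φ ψ : Fm s) → P (ψ ⇒ φ ∨ ψ)
    ax-∨E  : ∀ {s} (φ ψ χ : Fm s) → P ((φ ⇒ χ) ⇒ ((ψ ⇒ χ) ⇒ (φ ∨ ψ ⇒ χ)))
    ax-fal : ∀ {s} (φ : Fm s) → P (fal ⇒ φ)
    ax-tru : ∀ {s} → P (tru {s})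
    ax-∀E  : ∀ {s} (φ : Fm s) (t : ℕ) → P (∀' φ ⇒ inst t φ)
    ax-∃I  : ∀ {s} (φ : Fm s) (t : ℕ) → P (inst t φ ⇒ ∃' φ)
    mp     : ∀ {s} {φ ψ : Fm s} → P φ → P (φ ⇒ ψ) → P ψ
    gen-∀  : ∀ {s} {φ ψ : Fm s} → P (wk ψ ⇒ φ) → P (ψ ⇒ ∀' φ)
    gen-∃  : ∀ {s} {φ ψ : Fm s} → P (φ ⇒ wk ψ) → P (∃' φ ⇒ ψ)
    -- meta ∀-elimination for individual variables (substituting terms)
    ren-closed : ∀ {s} (ρ : ℕ → ℕ) {φ : Fm s} → P φ → P (ren ρ φ)
    ax-DN  : (F : Fm cl) → P (¬ ¬ F ⇒ F)
    q-∧    : (γ δ : Fm int) → P (⁇ (γ ∧ δ) ↔ ⁇ γ ∧ ⁇ δ)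
    q-∨    : (γ δ : Fm int) → P (⁇ (γ ∨ δ) ↔ ⁇ γ ∨ ⁇ δ)
    q-⇒    : (γ δ : Fm int) → P (⁇ (γ ⇒ δ) ⇒ (⁇ γ ⇒ ⁇ δ))
    q-fal  : P (¬ ⁇ (fal {int}))
    q-∃    : (θ : Fm int) → P (⁇ ∃' θ ↔ ∃' (⁇ θ))
    q-∀    : (θ : Fm int) → P (⁇ ∀' θ ⇒ ∀' (⁇ θ))
    i-!?   : (γ : Fm int) → P (γ ⇒ ! ⁇ γ)
    i-!fal : P (¬ ! (fal {cl}))
    c-?!   : (p : Fm cl) → P (⁇ ! p ⇒ p)
    i-!?!  : (p : Fm cl) → P (! p ⇒ ! ⁇ ! p)
    i-!K   : (p q : Fm cl) → P (! (p ⇒ q) ⇒ (! p ⇒ ! q))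
    rule-!E : {p : Fm cl} → P (! p) → P p
    rule-!I : {p : Fm cl} → P p → P (! p)

infix 2 _⊢QHC_ _≣QHC_
_⊢QHC_ : Principle → Principle → Set₁
A ⊢QHC B = (P : Pred) → IsQHC P → A P → B P

_≣QHC_ : Principle → Principle → Set₁
A ≣QHC B = (A ⊢QHC B) × (B ⊢QHC A)

-- The principles (α β : 0-ary problem variables, p q : 0-ary proper
-- predicate variables; as principles they range over all i-, resp.
-- c-formulas)

H-principle : Principle
H-principle P = (γ : Fm int) → P (⁇ (γ ∨ ¬ γ))

Pr1 Pr2 Pr3 Pr4 Pr5 Pr6 Pr7 Pr8 Pr9 Pr10 : Principle
Pr1 P = (α : Fm int) → P (⁇ (¬ ¬ α ⇒ α))
Pr2 P = (α : Fm int) → P (⁇ ¬ α ↔ ¬ ⁇ α)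
Pr3 P = (α : Fm int) → P (∇ α ↔ ¬ ¬ α)
Pr4 P = (α : Fm int) → P (⁇ (∇ α ∨ ¬ ∇ α))
Pr5 P = (α : Fm int) → P (¬ ¬ ∇ α ⇒ ∇ α)
Pr6 P = (α : Fm int) → P (⁇ (¬ ¬ ∇ α ⇒ ∇ α))
Pr7 P = (α β : Fm int) → P (⁇ (α ⇒ β) ↔ (⁇ α ⇒ ⁇ β))
Pr8 P = (p q : Fm cl) → P ((□ p ⇒ □ q) ↔ □ (□ p ⇒ □ q))
Pr9 P = (p : Fm cl) → P (□ p ↔ ◇ □ p)
Pr10 P = (p : Fm cl) → P (◇ p ↔ □ ◇ p)

module Submission where

open import Defs
open import Data.Product using (_×_; _,_)
open import Function using (_∘_)

-- □ = ?! is an S4 modality on c-formulas: T is ?!p → p and 4 is the instance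
-- γ := !p of γ → !?γ.  The H-principle says exactly that ? commutes with
-- negation (¬?γ → ?¬γ; the converse is always valid), and this in turn is
-- axiom 5 for □, which turns □ into an S5 modality.  Principles 2 and 7 are
-- rephrasings of the commutation, 8–10 are standard S5 equivalents of 5, and
-- 1, 3–6 follow because H makes ∇ = !? coincide with ¬¬ on i-formulas
-- (Φ → ∇Φ → ¬¬Φ always holds).

¬⁇⇒⁇¬-principle : Principle
¬⁇⇒⁇¬-principle P = (γ : Fm int) → P (¬ ⁇ γ ⇒ ⁇ ¬ γ)

□-5-principle : Principle
□-5-principle P = (F : Fm cl) → P (¬ □ F ⇒ □ ¬ □ F)

⊢QHC-trans : {A B C : Principle} → A ⊢QHC B → B ⊢QHC C → A ⊢QHC C
⊢QHC-trans A⊢B B⊢C P Q = B⊢C P Q ∘ A⊢B P Q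

≣QHC-trans : {A B C : Principle} → A ≣QHC B → B ≣QHC C → A ≣QHC C
≣QHC-trans (A⊢B , B⊢A) (B⊢C , C⊢B) = ⊢QHC-trans A⊢B B⊢C , ⊢QHC-trans C⊢B B⊢A

module Derivations {P : Pred} (Q : IsQHC P) where
  open IsQHC Q

  data Ctx (s : Sort) : Set where
    ∅   : Ctx s
    _▹_ : Ctx s → Fm s → Ctx s
  infixl 4 _▹_

  -- Hypotheses B₁ … Bₙ are curried into B₁ ⇒ … ⇒ Bₙ ⇒ A, so the deduction
  -- theorem (ƛ below) holds by definition.
  _⇛_ : ∀ {s} → Ctx s → Fm s → Fm s
  ∅       ⇛ A = A
  (Γ ▹ B) ⇛ A = Γ ⇛ (B ⇒ A)

  private variable
    s : Sort
    A B C D : Fm s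

  ⇒-refl : (A : Fm s) → P (A ⇒ A)
  ⇒-refl A = mp (ax-K A A) (mp (ax-K A (A ⇒ A)) (ax-S A (A ⇒ A) A))

  ⇒-const : (C : Fm s) → P A → P (C ⇒ A)
  ⇒-const C a = mp a (ax-K _ C)

  ⇒-cong : (C : Fm s) → P (A ⇒ B) → P ((C ⇒ A) ⇒ (C ⇒ B))
  ⇒-cong C ab = mp (⇒-const C ab) (ax-S C _ _)

  ⇒-cong₂ : (C : Fm s) → P (A ⇒ B ⇒ D) → P ((C ⇒ A) ⇒ (C ⇒ B) ⇒ (C ⇒ D))
  ⇒-cong₂ {A = A} {B} {D} C abd = mp (⇒-cong C abd) (⇒-cong (C ⇒ A) (ax-S C B D))

  ⇛-const : (Γ : Ctx s) → P A → P (Γ ⇛ A)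
  ⇛-const ∅       a = a
  ⇛-const (Γ ▹ C) a = ⇛-const Γ (⇒-const C a)

  ⇛-cong : (Γ : Ctx s) → P (A ⇒ B) → P ((Γ ⇛ A) ⇒ (Γ ⇛ B))
  ⇛-cong ∅       ab = ab
  ⇛-cong (Γ ▹ C) ab = ⇛-cong Γ (⇒-cong C ab)

  ⇛-cong₂ : (Γ : Ctx s) → P (A ⇒ B ⇒ D) → P ((Γ ⇛ A) ⇒ (Γ ⇛ B) ⇒ (Γ ⇛ D))
  ⇛-cong₂ ∅       abd = abd
  ⇛-cong₂ (Γ ▹ C) abd = ⇛-cong₂ Γ (⇒-cong₂ C abd)

  -- A record, so that Γ and A stay inferable although _⇛_ computes.
  infix 2 _⊢_
  record _⊢_ (Γ : Ctx s) (A : Fm s) : Set where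
    constructor derivation
    field holds : P (Γ ⇛ A)

  closed : ∅ ⊢ A → P A
  closed (derivation d) = d

  private variable
    Γ : Ctx s

  infixl 7 _·_
  infixr 5 _⨾_
  infix  4 ƛ_

  by : P A → Γ ⊢ A
  by {Γ = Γ} a = derivation (⇛-const Γ a)

  _·_ : Γ ⊢ A ⇒ B → Γ ⊢ A → Γ ⊢ B
  _·_ {Γ = Γ} {A} {B} (derivation f) (derivation a) =
    derivation (mp a (mp f (⇛-cong₂ Γ (⇒-refl (A ⇒ B)))))

  ƛ_ : Γ ▹ A ⊢ B → Γ ⊢ A ⇒ B
  ƛ derivation d = derivation d

  weaken : Γ ⊢ A → Γ ▹ B ⊢ A
  weaken {Γ = Γ} {A} {B} (derivation d) = derivation (mp d (⇛-cong Γ (ax-K A B)))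

  #0 : Γ ▹ A ⊢ A
  #0 {Γ = Γ} {A} = derivation (⇛-const Γ (⇒-refl A))

  #1 : Γ ▹ A ▹ B ⊢ A
  #1 = weaken #0

  _⨾_ : Γ ⊢ A ⇒ B → Γ ⊢ B ⇒ C → Γ ⊢ A ⇒ C
  f ⨾ g = ƛ weaken g · (weaken f · #0)

  ∧-elimˡ : Γ ⊢ A ∧ B → Γ ⊢ A
  ∧-elimˡ = by (ax-∧E₁ _ _) ·_

  ∧-elimʳ : Γ ⊢ A ∧ B → Γ ⊢ B
  ∧-elimʳ = by (ax-∧E₂ _ _) ·_

  ↔-intro : Γ ⊢ A ⇒ B → Γ ⊢ B ⇒ A → Γ ⊢ A ↔ B
  ↔-intro f g = by (ax-∧I _ _) · f · g

  ∨-introˡ : Γ ⊢ A → Γ ⊢ A ∨ B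
  ∨-introˡ = by (ax-∨I₁ _ _) ·_

  ∨-introʳ : Γ ⊢ B → Γ ⊢ A ∨ B
  ∨-introʳ = by (ax-∨I₂ _ _) ·_

  ∨-elim : Γ ⊢ A ∨ B → Γ ▹ A ⊢ C → Γ ▹ B ⊢ C → Γ ⊢ C
  ∨-elim d f g = by (ax-∨E _ _ _) · (ƛ f) · (ƛ g) · d

  fal-elim : Γ ⊢ fal → Γ ⊢ A
  fal-elim = by (ax-fal _) ·_

  contraposition : Γ ⊢ A ⇒ B → Γ ⊢ ¬ B ⇒ ¬ A
  contraposition f = ƛ ƛ #1 · (weaken (weaken f) · #0)

  ¬¬-map : Γ ⊢ A ⇒ B → Γ ⊢ ¬ ¬ A ⇒ ¬ ¬ B
  ¬¬-map f = contraposition (contraposition f)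

  ¬¬-excluded-middle : Γ ⊢ ¬ ¬ (A ∨ ¬ A)
  ¬¬-excluded-middle = ƛ #0 · ∨-introʳ (ƛ #1 · ∨-introˡ #0)

  ¬¬-elim : {Γ : Ctx cl} {F : Fm cl} → Γ ⊢ ¬ ¬ F → Γ ⊢ F
  ¬¬-elim = by (ax-DN _) ·_

  excluded-middle : {Γ : Ctx cl} {F : Fm cl} → Γ ⊢ F ∨ ¬ F
  excluded-middle = ¬¬-elim ¬¬-excluded-middle

module Modalities {P : Pred} (Q : IsQHC P) where
  open IsQHC Q
  open Derivations Q public

  private variable
    s : Sort
    Γ : Ctx s
    Φ Ψ : Fm int
    F G : Fm cl

  ⁇-necessitation : ∅ ⊢ Φ → Γ ⊢ ⁇ Φ
  ⁇-necessitation d = by (rule-!E (mp (closed d) (i-!? _)))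

  ⁇-mono : ∅ ⊢ Φ ⇒ Ψ → Γ ⊢ ⁇ Φ ⇒ ⁇ Ψ
  ⁇-mono d = by (q-⇒ _ _) · ⁇-necessitation d

  !-mono : ∅ ⊢ F ⇒ G → Γ ⊢ ! F ⇒ ! G
  !-mono d = by (i-!K _ _) · by (rule-!I (closed d))

  □-mono : ∅ ⊢ F ⇒ G → Γ ⊢ □ F ⇒ □ G
  □-mono d = ⁇-mono (!-mono d)

  ∇-unit : (Φ : Fm int) → Γ ⊢ Φ ⇒ ∇ Φ
  ∇-unit Φ = by (i-!? Φ)

  □-counit : (F : Fm cl) → Γ ⊢ □ F ⇒ F
  □-counit F = by (c-?! F)

  □-4 : (F : Fm cl) → Γ ⊢ □ F ⇒ □ □ F
  □-4 F = ⁇-mono (∇-unit (! F))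

  ⁇-∨-elim : (Φ Ψ : Fm int) → Γ ⊢ ⁇ (Φ ∨ Ψ) ⇒ ⁇ Φ ∨ ⁇ Ψ
  ⁇-∨-elim Φ Ψ = ∧-elimˡ (by (q-∨ Φ Ψ))

  ⁇-∨-intro : (Φ Ψ : Fm int) → Γ ⊢ ⁇ Φ ∨ ⁇ Ψ ⇒ ⁇ (Φ ∨ Ψ)
  ⁇-∨-intro Φ Ψ = ∧-elimʳ (by (q-∨ Φ Ψ))

  ⁇¬⇒¬⁇ : (Φ : Fm int) → Γ ⊢ ⁇ ¬ Φ ⇒ ¬ ⁇ Φ
  ⁇¬⇒¬⁇ Φ = ƛ ƛ by q-fal · (by (q-⇒ Φ fal) · #1 · #0)

  !-∧ : (F G : Fm cl) → Γ ⊢ ! F ⇒ ! G ⇒ ! (F ∧ G)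
  !-∧ F G = ƛ ƛ by (i-!K G (F ∧ G)) · (!-mono (by (ax-∧I F G)) · #1) · #0

  !-consistent : (F : Fm cl) → Γ ⊢ ! F ⇒ ! ¬ F ⇒ fal
  !-consistent F = ƛ ƛ by i-!fal · (!-mono (ƛ ∧-elimʳ #0 · ∧-elimˡ #0) · (!-∧ F (¬ F) · #1 · #0))

  ∇⇒¬¬ : (Φ : Fm int) → Γ ⊢ ∇ Φ ⇒ ¬ ¬ Φ
  ∇⇒¬¬ Φ = ƛ ƛ !-consistent (⁇ Φ) · #1 · (!-mono (⁇¬⇒¬⁇ Φ) · (∇-unit (¬ Φ) · #0))

  ¬¬∇-excluded-middle : (Φ : Fm int) → Γ ⊢ ¬ ¬ ∇ (Φ ∨ ¬ Φ)
  ¬¬∇-excluded-middle Φ = ¬¬-map (∇-unit (Φ ∨ ¬ Φ)) · ¬¬-excluded-middle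

module Equivalences (P : Pred) (Q : IsQHC P) where
  open IsQHC Q
  open Modalities Q

  H→¬⁇⇒⁇¬ : H-principle P → ¬⁇⇒⁇¬-principle P
  H→¬⁇⇒⁇¬ h γ = closed (ƛ ∨-elim (⁇-∨-elim γ (¬ γ) · by (h γ)) (fal-elim (#1 · #0)) #0)

  ¬⁇⇒⁇¬→H : ¬⁇⇒⁇¬-principle P → H-principle P
  ¬⁇⇒⁇¬→H n γ = closed (⁇-∨-intro γ (¬ γ) · ∨-elim excluded-middle
    (∨-introˡ #0)
    (∨-introʳ (by (n γ) · #0)))

  ¬⁇⇒⁇¬→□-5 : ¬⁇⇒⁇¬-principle P → □-5-principle P
  ¬⁇⇒⁇¬→□-5 n F = closed (by (n (! F)) ⨾ ⁇-mono (∇-unit (¬ ! F) ⨾ !-mono (⁇¬⇒¬⁇ (! F))))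

  -- γ yields !□?γ, which is inconsistent with !¬□?γ.
  □-5→¬⁇⇒⁇¬ : □-5-principle P → ¬⁇⇒⁇¬-principle P
  □-5→¬⁇⇒⁇¬ k γ = closed (contraposition (□-counit (⁇ γ)) ⨾ by (k (⁇ γ)) ⨾ ⁇-mono
    (ƛ ƛ !-consistent (□ ⁇ γ) · ((∇-unit γ ⨾ ∇-unit (∇ γ)) · #0) · #1))

  H→1 : H-principle P → Pr1 P
  H→1 h α = closed (⁇-mono (ƛ ƛ ∨-elim #1 #0 (fal-elim (#1 · #0))) · by (h α))

  1→H : Pr1 P → H-principle P
  1→H p γ = closed (by (q-⇒ _ _) · by (p (γ ∨ ¬ γ)) · ⁇-necessitation ¬¬-excluded-middle)

  ¬⁇⇒⁇¬→2 : ¬⁇⇒⁇¬-principle P → Pr2 P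
  ¬⁇⇒⁇¬→2 n α = closed (↔-intro (⁇¬⇒¬⁇ α) (by (n α)))

  2→¬⁇⇒⁇¬ : Pr2 P → ¬⁇⇒⁇¬-principle P
  2→¬⁇⇒⁇¬ p γ = closed (∧-elimʳ (by (p γ)))

  H→¬¬⇒∇ : H-principle P → (α : Fm int) → {Γ : Ctx int} → Γ ⊢ ¬ ¬ α ⇒ ∇ α
  H→¬¬⇒∇ h α = ∇-unit (¬ ¬ α) ⨾ !-mono (by (q-⇒ _ _) · by (H→1 h α))

  H→3 : H-principle P → Pr3 P
  H→3 h α = closed (↔-intro (∇⇒¬¬ α) (H→¬¬⇒∇ h α))

  3→H : Pr3 P → H-principle P
  3→H p γ = rule-!E (closed (∧-elimʳ (by (p (γ ∨ ¬ γ))) · ¬¬-excluded-middle))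

  H→4 : H-principle P → Pr4 P
  H→4 h α = h (∇ α)

  4→H : Pr4 P → H-principle P
  4→H p γ = closed (⁇-∨-intro γ (¬ γ) · ∨-elim (⁇-∨-elim (∇ γ) (¬ ∇ γ) · by (p γ))
    (∨-introˡ (□-counit (⁇ γ) · #0))
    (∨-introʳ (⁇-mono (contraposition (∇-unit γ)) · #0)))

  H→5 : H-principle P → Pr5 P
  H→5 h α = closed (ƛ H→¬¬⇒∇ h α · (ƛ #1 · (ƛ ∇⇒¬¬ α · #0 · #1)))

  5→H : Pr5 P → H-principle P
  5→H p γ = rule-!E (closed (by (p (γ ∨ ¬ γ)) · ¬¬∇-excluded-middle γ))

  H→6 : H-principle P → Pr6 P
  H→6 h α = closed (⁇-necessitation (by (H→5 h α)))

  6→H : Pr6 P → H-principle P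
  6→H p γ = closed (□-counit _ · (by (q-⇒ _ _) · by (p (γ ∨ ¬ γ))
    · ⁇-necessitation (¬¬∇-excluded-middle γ)))

  ¬⁇⇒⁇¬→7 : ¬⁇⇒⁇¬-principle P → Pr7 P
  ¬⁇⇒⁇¬→7 n α β = closed (↔-intro (by (q-⇒ α β)) (ƛ ∨-elim excluded-middle
    (⁇-mono (by (ax-K β α)) · (#1 · #0))
    (⁇-mono (ƛ ƛ fal-elim (#1 · #0)) · (by (n α) · #0))))

  7→¬⁇⇒⁇¬ : Pr7 P → ¬⁇⇒⁇¬-principle P
  7→¬⁇⇒⁇¬ p γ = closed (ƛ ∧-elimʳ (by (p γ fal)) · (ƛ fal-elim (#1 · #0)))

  □-5→8 : □-5-principle P → Pr8 P
  □-5→8 k p q = closed (↔-intro (ƛ ∨-elim excluded-middle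
      ((□-4 q ⨾ □-mono (by (ax-K (□ q) (□ p)))) · (#1 · #0))
      ((by (k p) ⨾ □-mono (ƛ ƛ fal-elim (#1 · #0))) · #0))
    (□-counit (□ p ⇒ □ q)))

  8→□-5 : Pr8 P → □-5-principle P
  8→□-5 p F = closed ((ƛ ƛ fal-elim (#1 · #0)) ⨾ ∧-elimˡ (by (p F fal))
    ⨾ □-mono (ƛ ƛ □-counit fal · (#1 · #0)))

  □-5→9 : □-5-principle P → Pr9 P
  □-5→9 k p = closed (↔-intro (ƛ ƛ □-counit (¬ □ p) · #0 · #1) (ƛ ¬¬-elim (ƛ #1 · (by (k p) · #0))))

  9→□-5 : Pr9 P → □-5-principle P
  9→□-5 p F = closed (ƛ ¬¬-elim (ƛ #1 · (∧-elimʳ (by (p F)) · #0)))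

  □-5→10 : □-5-principle P → Pr10 P
  □-5→10 k p = closed (↔-intro (by (k (¬ p))) (□-counit (◇ p)))

  -- □F and □¬¬F are interderivable, and Pr10 at ¬F is 5 at ¬¬F.
  10→□-5 : Pr10 P → □-5-principle P
  10→□-5 p F = closed (contraposition (□-mono (ƛ ¬¬-elim #0)) ⨾ ∧-elimˡ (by (p (¬ F)))
    ⨾ □-mono (contraposition (□-mono (ƛ ƛ #0 · #1))))

open Equivalences

H≣¬⁇⇒⁇¬ : H-principle ≣QHC ¬⁇⇒⁇¬-principle
H≣¬⁇⇒⁇¬ = H→¬⁇⇒⁇¬ , ¬⁇⇒⁇¬→H

H≣□-5 : H-principle ≣QHC □-5-principle
H≣□-5 = ≣QHC-trans H≣¬⁇⇒⁇¬ (¬⁇⇒⁇¬→□-5 , □-5→¬⁇⇒⁇¬)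

mainTheorem12 : (H-principle ≣QHC Pr1) × (H-principle ≣QHC Pr2) × (H-principle ≣QHC Pr3) × (H-principle ≣QHC Pr4) × (H-principle ≣QHC Pr5) × (H-principle ≣QHC Pr6) × (H-principle ≣QHC Pr7) × (H-principle ≣QHC Pr8) × (H-principle ≣QHC Pr9) × (H-principle ≣QHC Pr10)
mainTheorem12 =
    (H→1 , 1→H)
  , ≣QHC-trans H≣¬⁇⇒⁇¬ (¬⁇⇒⁇¬→2 , 2→¬⁇⇒⁇¬)
  , (H→3 , 3→H)
  , (H→4 , 4→H)
  , (H→5 , 5→H)
  , (H→6 , 6→H)
  , ≣QHC-trans H≣¬⁇⇒⁇¬ (¬⁇⇒⁇¬→7 , 7→¬⁇⇒⁇¬)
  , ≣QHC-trans H≣□-5 (□-5→8 , 8→□-5)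
  , ≣QHC-trans H≣□-5 (□-5→9 , 9→□-5)
  , ≣QHC-trans H≣□-5 (□-5→10 , 10→□-5)
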